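{- Let $p>2$ be prime, $n\ge1$, and let $\tilde G$ be the group of matrices $g_{a,b,d}=\begin{pmatrix}a&b\\0&d\end{pmatrix}$ with $a,d\in(\mathbb{Z}/p^n\mathbb{Z})^\times$, $b\in\mathbb{Z}/p^n\mathbb{Z}$, acting on $\mu_{p^n}$ by $g_{a,b,d}\cdot\zeta=\zeta^{ad}$. Then $$H^1(\tilde G,\mu_{p^n})\simeq\{\zeta\in\mu_{p^n}\mid \zeta^{d^2}=\zeta\ \text{for all } d\in(\mathbb{Z}/p^n\mathbb{Z})^\times\}.$$ Moreover, if $p>3$, then $H^1(\tilde G,\mu_{p^n})=0$.
   Context: $\mu_{p^n}$ is the group of $p^n$-th roots of unity. -}

module Defs where

open import Data.Nat using (ℕ)
open import Data.Integer using (ℤ; +_; _+_; _-_; _*_; 0ℤ; 1ℤ)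
open import Data.Integer.Divisibility using (_∣_)
open import Data.Product using (Σ; _×_; ∃)

-- Z/NZ is modelled by ℤ together with congruence modulo N.
-- μ_N (N = p^n) is a cyclic group of order N; we identify it with Z/NZ
-- written additively:  ζ^k  corresponds to  k * x.
Cong : ℕ → ℤ → ℤ → Set
Cong N x y = (+ N) ∣ (x - y)

IsUnit : ℕ → ℤ → Set
IsUnit N a = Σ ℤ λ a' → Cong N (a * a') 1ℤ

-- A 1-cochain of G~ with values in μ_N is a function f(a,b,d) of the
-- matrix g_{a,b,d}; only its values on G~ (a,d units) matter.
Cochain : Set
Cochain = ℤ → ℤ → ℤ → ℤ

WellDefined : ℕ → Cochain → Set
WellDefined N f = ∀ a b d a' b' d' → IsUnit N a → IsUnit N d →
  Cong N a a' → Cong N b b' → Cong N d d' →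
  Cong N (f a b d) (f a' b' d')

-- crossed homomorphism (1-cocycle) condition:
--   f(g h) = f(g) + g · f(h),  where g_{a,b,d} · x = (a d) x
-- and g_{a,b,d} g_{a',b',d'} = g_{aa', ab'+bd', dd'}
CocycleEq : ℕ → Cochain → Set
CocycleEq N f = ∀ a b d a' b' d' →
  IsUnit N a → IsUnit N d → IsUnit N a' → IsUnit N d' →
  Cong N (f (a * a') (a * b' + b * d') (d * d'))
         (f a b d + (a * d) * f a' b' d')

record Cocycle (N : ℕ) : Set where
  field
    fn       : Cochain
    wellDef  : WellDefined N fn
    cocycle  : CocycleEq N fn
open Cocycle public

-- coboundary (principal crossed homomorphism): f(g) = g·m - m
IsCoboundary : (N : ℕ) → Cocycle N → Set
IsCoboundary N f = Σ ℤ λ m → ∀ a b d → IsUnit N a → IsUnit N d →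
  Cong N (fn f a b d) ((a * d - 1ℤ) * m)

IsSum : (N : ℕ) → Cocycle N → Cocycle N → Cocycle N → Set
IsSum N h f g = ∀ a b d → IsUnit N a → IsUnit N d →
  Cong N (fn h a b d) (fn f a b d + fn g a b d)

InS : ℕ → ℤ → Set
InS N x = ∀ d → IsUnit N d → Cong N ((d * d) * x) x

-- H^1(G~, μ_N) ≅ S : a homomorphism Z^1 → S which is surjective with
-- kernel exactly B^1 (first isomorphism theorem description of the
-- isomorphism Z^1/B^1 ≅ S).
record H1IsoS (N : ℕ) : Set where
  field
    φ         : Cocycle N → ℤ
    φ-inS     : ∀ f → InS N (φ f)
    φ-hom     : ∀ h f g → IsSum N h f g → Cong N (φ h) (φ f + φ g)
    φ-surj    : ∀ x → InS N x → Σ (Cocycle N) λ f → Cong N (φ f) x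
    φ-ker⇒    : ∀ f → Cong N (φ f) 0ℤ → IsCoboundary N f
    φ-ker⇐    : ∀ f → IsCoboundary N f → Cong N (φ f) 0ℤ

H1Vanishes : ℕ → Set
H1Vanishes N = ∀ (f : Cocycle N) → IsCoboundary N f

{-# OPTIONS --safe #-}
-- The isomorphism is f ↦ t = f(g(1,1,1)). The action is trivial on the unipotent matrices
-- g(1,b,1), so f is additive there and f(g(1,b,1)) = b t. Two factorisations of g(1,1,d) give
-- d t = d⁻¹ t, hence d² t = t; conversely t is attained by the cocycle g(a,b,d) ↦ b d t. If t = 0,
-- comparing g(2,0,1) g with g g(2,0,1) gives f(g) = (ad − 1) f(g(2,0,1)), a coboundary (2 is a
-- unit since p is odd). For p > 3, taking d = 2 gives 3t = 0, so t = 0 as 3 is a unit.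
module Submission where

open import Defs
open import Data.Nat using (ℕ; _>_; _≥_; _^_)
open import Data.Nat.Primality using (Prime)
open import Data.Product using (_×_)

import Data.Nat as ℕ
open import Data.Nat.Coprimality using (coprime-Bézout; prime⇒coprime)
open import Data.Nat.GCD using (module Bézout)
open import Data.Nat.Divisibility using (1∣_)
open import Data.Integer using (ℤ; +_; -[1+_]; _+_; _-_; _*_; -_; 0ℤ; 1ℤ)
import Data.Integer.Properties as ℤ
import Data.Integer.Divisibility.Signed as Signed
open import Data.Integer.Tactic.RingSolver using (solve-∀)
open import Data.Product using (_,_)
open import Relation.Binary.Bundles using (Setoid)
open import Relation.Binary.Structures using (IsEquivalence)
open import Relation.Binary.PropositionalEquality using (_≡_; refl; sym; trans; cong; cong₂; subst; module ≡-Reasoning)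
import Relation.Binary.Reasoning.Setoid as SetoidReasoning

module Modular (N : ℕ) where

  -- Cong N is not injective in its two arguments; wrapping it lets Agda infer them.
  infix 4 _≈_
  record _≈_ (x y : ℤ) : Set where
    constructor ⟦_⟧
    field ≈⇒Cong : Cong N x y
  open _≈_ public

  private variable a b x y u v x′ y′ : ℤ

  ≈⇒∣ : x ≈ y → + N Signed.∣ x - y
  ≈⇒∣ ⟦ c ⟧ = Signed.∣ᵤ⇒∣ c

  ∣⇒≈ : + N Signed.∣ x - y → x ≈ y
  ∣⇒≈ d = ⟦ Signed.∣⇒∣ᵤ d ⟧

  ≈-by-multiple : ∀ k → x - y ≡ k * + N → x ≈ y
  ≈-by-multiple k eq = ∣⇒≈ (Signed.divides k eq)

  ≈-by-difference : x′ - y′ ≡ x - y → x ≈ y → x′ ≈ y′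
  ≈-by-difference eq p = ∣⇒≈ (subst (Signed._∣_ (+ N)) (sym eq) (≈⇒∣ p))

  ≈-by-combination : ∀ s t → x - y ≡ s * (a - b) + t * (u - v) → a ≈ b → u ≈ v → x ≈ y
  ≈-by-combination s t eq p q = ∣⇒≈ (subst (Signed._∣_ (+ N)) (sym eq)
    (Signed.∣m∣n⇒∣m+n (Signed.∣n⇒∣m*n s (≈⇒∣ p)) (Signed.∣n⇒∣m*n t (≈⇒∣ q))))

  ≈-reflexive : x ≡ y → x ≈ y
  ≈-reflexive {x} refl = ≈-by-multiple 0ℤ (x-x≡0*n x (+ N))
    where
    x-x≡0*n : ∀ x n → x - x ≡ 0ℤ * n
    x-x≡0*n = solve-∀

  ≈-refl : x ≈ x
  ≈-refl = ≈-reflexive refl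

  ≈-sym : x ≈ y → y ≈ x
  ≈-sym {x} {y} p = ≈-by-combination (- 1ℤ) 0ℤ (eq x y) p p
    where
    eq : ∀ x y → y - x ≡ - 1ℤ * (x - y) + 0ℤ * (x - y)
    eq = solve-∀

  ≈-trans : x ≈ y → y ≈ u → x ≈ u
  ≈-trans {x} {y} {u} p q = ≈-by-combination 1ℤ 1ℤ (eq x y u) p q
    where
    eq : ∀ x y u → x - u ≡ 1ℤ * (x - y) + 1ℤ * (y - u)
    eq = solve-∀

  ≈-isEquivalence : IsEquivalence _≈_
  ≈-isEquivalence = record { refl = ≈-refl ; sym = ≈-sym ; trans = ≈-trans }

  ≈-setoid : Setoid _ _
  ≈-setoid = record { isEquivalence = ≈-isEquivalence }

  module ≈-Reasoning = SetoidReasoning ≈-setoid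

  +-cong : x ≈ y → u ≈ v → x + u ≈ y + v
  +-cong {x} {y} {u} {v} p q = ≈-by-combination 1ℤ 1ℤ (eq x y u v) p q
    where
    eq : ∀ x y u v → (x + u) - (y + v) ≡ 1ℤ * (x - y) + 1ℤ * (u - v)
    eq = solve-∀

  -‿cong : x ≈ y → - x ≈ - y
  -‿cong {x} {y} p = ≈-by-combination (- 1ℤ) 0ℤ (eq x y) p p
    where
    eq : ∀ x y → - x - - y ≡ - 1ℤ * (x - y) + 0ℤ * (x - y)
    eq = solve-∀

  *-cong : x ≈ y → u ≈ v → x * u ≈ y * v
  *-cong {x} {y} {u} {v} p q = ≈-by-combination u y (eq x y u v) p q
    where
    eq : ∀ x y u v → x * u - y * v ≡ u * (x - y) + y * (u - v)
    eq = solve-∀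

  *-congˡ : ∀ c → x ≈ y → c * x ≈ c * y
  *-congˡ c = *-cong (≈-refl {c})

  +-congˡ : ∀ c → x ≈ y → c + x ≈ c + y
  +-congˡ c = +-cong (≈-refl {c})

  x+y≈u⇒x≈u-y : ∀ x y → x + y ≈ u → x ≈ u - y
  x+y≈u⇒x≈u-y {u} x y = ≈-by-difference (eq x y u)
    where
    eq : ∀ x y u → x - (u - y) ≡ (x + y) - u
    eq = solve-∀

  additive⇒linear : (h : ℤ → ℤ) → (∀ a b → h (a + b) ≈ h a + h b) → ∀ k → h k ≈ k * h 1ℤ
  additive⇒linear h h-+ = linear
    where
    open ≈-Reasoning

    h-0 : h 0ℤ ≈ 0ℤ
    h-0 = ≈-trans (x+y≈u⇒x≈u-y (h 0ℤ) (h 0ℤ) (≈-sym (h-+ 0ℤ 0ℤ))) (≈-reflexive (ℤ.+-inverseʳ (h 0ℤ)))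

    natural : ∀ m → h (+ m) ≈ + m * h 1ℤ
    natural ℕ.zero    = h-0
    natural (ℕ.suc m) = begin
      h (1ℤ + + m)          ≈⟨ h-+ 1ℤ (+ m) ⟩
      h 1ℤ + h (+ m)        ≈⟨ +-congˡ (h 1ℤ) (natural m) ⟩
      h 1ℤ + + m * h 1ℤ     ≡⟨ eq (+ m) (h 1ℤ) ⟩
      (1ℤ + + m) * h 1ℤ     ∎
      where
      eq : ∀ m x → x + m * x ≡ (1ℤ + m) * x
      eq = solve-∀

    linear : ∀ k → h k ≈ k * h 1ℤ
    linear (+ m)    = natural m
    linear -[1+ m ] = begin
      h -[1+ m ]               ≈⟨ x+y≈u⇒x≈u-y (h -[1+ m ]) (h (+ ℕ.suc m)) h[-k]+h[k]≈h[0] ⟩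
      h 0ℤ - h (+ ℕ.suc m)     ≈⟨ +-cong h-0 (-‿cong (natural (ℕ.suc m))) ⟩
      0ℤ - + ℕ.suc m * h 1ℤ    ≡⟨ eq (+ ℕ.suc m) (h 1ℤ) ⟩
      - + ℕ.suc m * h 1ℤ       ∎
      where
      h[-k]+h[k]≈h[0] : h -[1+ m ] + h (+ ℕ.suc m) ≈ h 0ℤ
      h[-k]+h[k]≈h[0] = ≈-trans (≈-sym (h-+ -[1+ m ] (+ ℕ.suc m)))
                                (≈-reflexive (cong h (ℤ.+-inverseˡ (+ ℕ.suc m))))
      eq : ∀ m x → 0ℤ - m * x ≡ - m * x
      eq = solve-∀

  1-unit : IsUnit N 1ℤ
  1-unit = 1ℤ , ≈⇒Cong (≈-refl {1ℤ})

  *-unit : IsUnit N a → IsUnit N b → IsUnit N (a * b)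
  *-unit {a} {b} (a⁻¹ , aa⁻¹≡1) (b⁻¹ , bb⁻¹≡1) = a⁻¹ * b⁻¹ , ≈⇒Cong (begin
    (a * b) * (a⁻¹ * b⁻¹)   ≡⟨ eq a b a⁻¹ b⁻¹ ⟩
    (a * a⁻¹) * (b * b⁻¹)   ≈⟨ *-cong {a * a⁻¹} {1ℤ} ⟦ aa⁻¹≡1 ⟧ ⟦ bb⁻¹≡1 ⟧ ⟩
    1ℤ * 1ℤ                 ∎)
    where
    open ≈-Reasoning
    eq : ∀ a b a⁻¹ b⁻¹ → (a * b) * (a⁻¹ * b⁻¹) ≡ (a * a⁻¹) * (b * b⁻¹)
    eq = solve-∀

module Cohomology {N : ℕ} where

  open Modular N
  open ≈-Reasoning

  unipotentValue : Cocycle N → ℤ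
  unipotentValue f = fn f 1ℤ 1ℤ 1ℤ

  module _ (f : Cocycle N) where

    private
      F : Cochain
      F = fn f

    cocycle-at : ∀ {A B D} a b d a′ b′ d′ →
      IsUnit N a → IsUnit N d → IsUnit N a′ → IsUnit N d′ →
      a * a′ ≈ A → a * b′ + b * d′ ≈ B → d * d′ ≈ D →
      F A B D ≈ F a b d + (a * d) * F a′ b′ d′
    cocycle-at {A} {B} {D} a b d a′ b′ d′ ua ud ua′ ud′ ⟦ ≡A ⟧ ⟦ ≡B ⟧ ⟦ ≡D ⟧ =
      ≈-trans {y = F (a * a′) (a * b′ + b * d′) (d * d′)}
        (≈-sym ⟦ wellDef f (a * a′) (a * b′ + b * d′) (d * d′) A B D
                   (*-unit {a} {a′} ua ua′) (*-unit {d} {d′} ud ud′) ≡A ≡B ≡D ⟧)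
        ⟦ cocycle f a b d a′ b′ d′ ua ud ua′ ud′ ⟧

    unipotent : ℤ → ℤ
    unipotent b = F 1ℤ b 1ℤ

    unipotent-linear : ∀ b → unipotent b ≈ b * unipotentValue f
    unipotent-linear = additive⇒linear unipotent λ b b′ → begin
      F 1ℤ (b + b′) 1ℤ
        ≈⟨ cocycle-at 1ℤ b 1ℤ 1ℤ b′ 1ℤ 1-unit 1-unit 1-unit 1-unit ≈-refl (≈-reflexive (eq b b′)) ≈-refl ⟩
      unipotent b + 1ℤ * unipotent b′
        ≡⟨ cong (λ z → unipotent b + z) (ℤ.*-identityˡ (unipotent b′)) ⟩
      unipotent b + unipotent b′ ∎
      where
      eq : ∀ b b′ → 1ℤ * b′ + b * 1ℤ ≡ b + b′
      eq = solve-∀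

    unipotentValue-inS : InS N (unipotentValue f)
    unipotentValue-inS d ud@(d⁻¹ , dd⁻¹≡1) = ≈⇒Cong (begin
      (d * d) * t    ≡⟨ ℤ.*-assoc d d t ⟩
      d * (d * t)    ≈⟨ *-congˡ d d*t≈d⁻¹*t ⟩
      d * (d⁻¹ * t)  ≡⟨ ℤ.*-assoc d d⁻¹ t ⟨
      (d * d⁻¹) * t  ≈⟨ *-cong {d * d⁻¹} {1ℤ} ⟦ dd⁻¹≡1 ⟧ ≈-refl ⟩
      1ℤ * t         ≡⟨ ℤ.*-identityˡ t ⟩
      t              ∎)
      where
      t diag : ℤ
      t = unipotentValue f
      diag = F 1ℤ 0ℤ d

      -- g(1,1,d) = g(1,0,d) g(1,1,1) = g(1,d⁻¹,1) g(1,0,d)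
      diagonal-first : F 1ℤ 1ℤ d ≈ diag + (1ℤ * d) * t
      diagonal-first = cocycle-at 1ℤ 0ℤ d 1ℤ 1ℤ 1ℤ 1-unit ud 1-unit 1-unit
                ≈-refl ≈-refl (≈-reflexive (ℤ.*-identityʳ d))
      unipotent-first : F 1ℤ 1ℤ d ≈ unipotent d⁻¹ + 1ℤ * diag
      unipotent-first = cocycle-at 1ℤ d⁻¹ 1ℤ 1ℤ 0ℤ d 1-unit 1-unit 1-unit ud
        ≈-refl
        (≈-trans (≈-reflexive (trans (ℤ.+-identityˡ (d⁻¹ * d)) (ℤ.*-comm d⁻¹ d))) ⟦ dd⁻¹≡1 ⟧)
        (≈-reflexive (ℤ.*-identityˡ d))

      d*t≈d⁻¹*t : d * t ≈ d⁻¹ * t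
      d*t≈d⁻¹*t = ≈-trans
        (≈-by-difference (eq diag d t (unipotent d⁻¹)) (≈-trans (≈-sym diagonal-first) unipotent-first))
        (unipotent-linear d⁻¹)
        where
        eq : ∀ x d t y → d * t - y ≡ (x + (1ℤ * d) * t) - (y + 1ℤ * x)
        eq = solve-∀

    unipotentValue≈0⇒coboundary : IsUnit N (+ 2) → unipotentValue f ≈ 0ℤ → IsCoboundary N f
    unipotentValue≈0⇒coboundary 2-unit t≈0 = m , λ a b d ua ud → ≈⇒Cong (value a b d ua ud)
      where
      m : ℤ
      m = F (+ 2) 0ℤ 1ℤ

      -- g(2,0,1) g(a,b,d) = g(1,b d⁻¹,1) g(a,b,d) g(2,0,1), and f vanishes on the unipotent factor.
      value : ∀ a b d → IsUnit N a → IsUnit N d → F a b d ≈ (a * d - 1ℤ) * m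
      value a b d ua ud@(d⁻¹ , dd⁻¹≡1) = ≈-by-difference (eq g m a d) (begin
        m + (+ 2 * 1ℤ) * g                ≈⟨ ≈-sym left ⟩
        F (+ 2 * a) (+ 2 * b) d           ≈⟨ shear ⟩
        unipotent β + 1ℤ * F (+ 2 * a) b d
          ≈⟨ +-cong (≈-trans (unipotent-linear β) (*-congˡ β t≈0))
                    (≈-reflexive (ℤ.*-identityˡ (F (+ 2 * a) b d))) ⟩
        β * 0ℤ + F (+ 2 * a) b d          ≡⟨ cong (_+ F (+ 2 * a) b d) (ℤ.*-zeroʳ β) ⟩
        0ℤ + F (+ 2 * a) b d              ≡⟨ ℤ.+-identityˡ (F (+ 2 * a) b d) ⟩
        F (+ 2 * a) b d                   ≈⟨ right ⟩
        g + (a * d) * m                   ∎)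
        where
        g β : ℤ
        g = F a b d
        β = b * d⁻¹

        left : F (+ 2 * a) (+ 2 * b) d ≈ m + (+ 2 * 1ℤ) * g
        left = cocycle-at (+ 2) 0ℤ 1ℤ a b d 2-unit 1-unit ua ud
                 ≈-refl (≈-reflexive (ℤ.+-identityʳ (+ 2 * b))) (≈-reflexive (ℤ.*-identityˡ d))

        right : F (+ 2 * a) b d ≈ g + (a * d) * m
        right = cocycle-at a b d (+ 2) 0ℤ 1ℤ ua ud 2-unit 1-unit
                  (≈-reflexive (ℤ.*-comm a (+ 2))) (≈-reflexive (eqʳ a b)) (≈-reflexive (ℤ.*-identityʳ d))
          where
          eqʳ : ∀ a b → a * 0ℤ + b * 1ℤ ≡ b
          eqʳ = solve-∀

        shear : F (+ 2 * a) (+ 2 * b) d ≈ unipotent β + 1ℤ * F (+ 2 * a) b d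
        shear = cocycle-at 1ℤ β 1ℤ (+ 2 * a) b d 1-unit 1-unit (*-unit {+ 2} {a} 2-unit ua) ud
                  (≈-reflexive (ℤ.*-identityˡ (+ 2 * a))) βd≈b (≈-reflexive (ℤ.*-identityˡ d))
          where
          βd≈b : 1ℤ * b + β * d ≈ + 2 * b
          βd≈b = begin
            1ℤ * b + β * d    ≡⟨ eq₁ b d d⁻¹ ⟩
            b + b * (d * d⁻¹) ≈⟨ +-congˡ b (*-congˡ b ⟦ dd⁻¹≡1 ⟧) ⟩
            b + b * 1ℤ        ≡⟨ eq₂ b ⟩
            + 2 * b           ∎
            where
            eq₁ : ∀ b d d⁻¹ → 1ℤ * b + (b * d⁻¹) * d ≡ b + b * (d * d⁻¹)
            eq₁ = solve-∀
            eq₂ : ∀ b → b + b * 1ℤ ≡ + 2 * b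
            eq₂ = solve-∀

        eq : ∀ g m a d → g - (a * d - 1ℤ) * m ≡ (m + (+ 2 * 1ℤ) * g) - (g + (a * d) * m)
        eq = solve-∀

    coboundary⇒unipotentValue≈0 : IsCoboundary N f → unipotentValue f ≈ 0ℤ
    coboundary⇒unipotentValue≈0 (_ , f≈) = ⟦ f≈ 1ℤ 1ℤ 1ℤ 1-unit 1-unit ⟧

  cocycleOf : (x : ℤ) → InS N x → Cocycle N
  fn (cocycleOf x _) a b d = b * d * x
  wellDef (cocycleOf x _) a b d a′ b′ d′ _ _ _ b≡b′ d≡d′ =
    ≈⇒Cong (*-cong {b * d} {b′ * d′} (*-cong {b} {b′} ⟦ b≡b′ ⟧ ⟦ d≡d′ ⟧) (≈-refl {x}))
  cocycle (cocycleOf x x∈S) a b d a′ b′ d′ _ _ _ ud′ = ≈⇒Cong (begin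
    (a * b′ + b * d′) * (d * d′) * x            ≡⟨ eq₁ a b d b′ d′ x ⟩
    a * b′ * d * d′ * x + b * d * (d′ * d′ * x)
      ≈⟨ +-congˡ (a * b′ * d * d′ * x) (*-congˡ (b * d) ⟦ x∈S d′ ud′ ⟧) ⟩
    a * b′ * d * d′ * x + b * d * x             ≡⟨ eq₂ a b d b′ d′ x ⟩
    b * d * x + (a * d) * (b′ * d′ * x)         ∎)
    where
    eq₁ : ∀ a b d b′ d′ x →
          (a * b′ + b * d′) * (d * d′) * x ≡ a * b′ * d * d′ * x + b * d * (d′ * d′ * x)
    eq₁ = solve-∀
    eq₂ : ∀ a b d b′ d′ x →
          a * b′ * d * d′ * x + b * d * x ≡ b * d * x + (a * d) * (b′ * d′ * x)
    eq₂ = solve-∀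

  unipotentValue-cocycleOf : ∀ x x∈S → unipotentValue (cocycleOf x x∈S) ≡ x
  unipotentValue-cocycleOf x _ = ℤ.*-identityˡ x

  h1IsoS : IsUnit N (+ 2) → H1IsoS N
  h1IsoS 2-unit = record
    { φ      = unipotentValue
    ; φ-inS  = unipotentValue-inS
    ; φ-hom  = λ h f g h≡f+g → h≡f+g 1ℤ 1ℤ 1ℤ 1-unit 1-unit
    ; φ-surj = λ x x∈S → cocycleOf x x∈S , ≈⇒Cong (≈-reflexive (unipotentValue-cocycleOf x x∈S))
    ; φ-ker⇒ = λ f t≡0 → unipotentValue≈0⇒coboundary f 2-unit ⟦ t≡0 ⟧
    ; φ-ker⇐ = λ f f-cob → ≈⇒Cong (coboundary⇒unipotentValue≈0 f f-cob)
    }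

  inS⇒≈0 : IsUnit N (+ 2) → IsUnit N (+ 3) → ∀ x → InS N x → x ≈ 0ℤ
  inS⇒≈0 2-unit (w , 3w≡1) x x∈S = ≈-by-combination (- x) w (eq x w) 3w≈1 4x≈x
    where
    3w≈1 : + 3 * w ≈ 1ℤ
    3w≈1 = ⟦ 3w≡1 ⟧
    4x≈x : (+ 2 * + 2) * x ≈ x
    4x≈x = ⟦ x∈S (+ 2) 2-unit ⟧
    eq : ∀ x w → x - 0ℤ ≡ - x * (+ 3 * w - 1ℤ) + w * ((+ 2 * + 2) * x - x)
    eq = solve-∀

  h1Vanishes : IsUnit N (+ 2) → IsUnit N (+ 3) → H1Vanishes N
  h1Vanishes 2-unit 3-unit f = unipotentValue≈0⇒coboundary f 2-unit
    (inS⇒≈0 2-unit 3-unit (unipotentValue f) (unipotentValue-inS f))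

1+*≡*⇒ℤ : ∀ x m y n → 1 ℕ.+ x ℕ.* m ≡ y ℕ.* n → 1ℤ + + x * + m ≡ + y * + n
1+*≡*⇒ℤ x m y n eq = begin
  1ℤ + + x * + m      ≡⟨ cong (λ z → 1ℤ + z) (ℤ.pos-* x m) ⟨
  + (1 ℕ.+ x ℕ.* m)   ≡⟨ cong +_ eq ⟩
  + (y ℕ.* n)         ≡⟨ ℤ.pos-* y n ⟩
  + y * + n           ∎
  where open ≡-Reasoning

prime⇒unit : ∀ {p q} .{{_ : ℕ.NonZero q}} → Prime p → q ℕ.< p → IsUnit p (+ q)
prime⇒unit {p} {q} p-prime q<p with coprime-Bézout (prime⇒coprime p-prime q<p)
... | Bézout.+- x y 1+yq≡xp = - + y , Signed.∣⇒∣ᵤ (Signed.divides (- + x) (begin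
  + q * - + y - 1ℤ     ≡⟨ eq (+ q) (+ y) ⟩
  - (1ℤ + + y * + q)   ≡⟨ cong -_ (1+*≡*⇒ℤ y q x p 1+yq≡xp) ⟩
  - (+ x * + p)        ≡⟨ ℤ.neg-distribˡ-* (+ x) (+ p) ⟩
  - + x * + p          ∎))
  where
  open ≡-Reasoning
  eq : ∀ q y → q * - y - 1ℤ ≡ - (1ℤ + y * q)
  eq = solve-∀
... | Bézout.-+ x y 1+xp≡yq = + y , Signed.∣⇒∣ᵤ (Signed.divides (+ x) (begin
  + q * + y - 1ℤ           ≡⟨ cong (_- 1ℤ) (ℤ.*-comm (+ q) (+ y)) ⟩
  + y * + q - 1ℤ           ≡⟨ cong (_- 1ℤ) (1+*≡*⇒ℤ x p y q 1+xp≡yq) ⟨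
  1ℤ + + x * + p - 1ℤ      ≡⟨ eq (+ x * + p) ⟩
  + x * + p                ∎))
  where
  open ≡-Reasoning
  eq : ∀ z → 1ℤ + z - 1ℤ ≡ z
  eq = solve-∀

-- If q a ≡ 1 + k M and q b ≡ 1 + l K, then q (a + b − q a b) ≡ 1 − k l M K.
unit-*-modulus : ∀ M K {q} → IsUnit M q → IsUnit K q → IsUnit (M ℕ.* K) q
unit-*-modulus M K {q} (a , qa≡1) (b , qb≡1)
  with Signed.∣ᵤ⇒∣ {+ M} {q * a - 1ℤ} qa≡1 | Signed.∣ᵤ⇒∣ {+ K} {q * b - 1ℤ} qb≡1
... | Signed.divides k qa-1≡kM | Signed.divides l qb-1≡lK =
  a + b - q * a * b , Signed.∣⇒∣ᵤ (Signed.divides (- (k * l)) (begin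
    q * (a + b - q * a * b) - 1ℤ      ≡⟨ eq₁ q a b ⟩
    - ((q * a - 1ℤ) * (q * b - 1ℤ))   ≡⟨ cong₂ (λ x y → - (x * y)) qa-1≡kM qb-1≡lK ⟩
    - ((k * + M) * (l * + K))         ≡⟨ eq₂ k l (+ M) (+ K) ⟩
    - (k * l) * (+ M * + K)           ≡⟨ cong (- (k * l) *_) (ℤ.pos-* M K) ⟨
    - (k * l) * + (M ℕ.* K)           ∎))
  where
  open ≡-Reasoning
  eq₁ : ∀ q a b → q * (a + b - q * a * b) - 1ℤ ≡ - ((q * a - 1ℤ) * (q * b - 1ℤ))
  eq₁ = solve-∀
  eq₂ : ∀ k l m n → - ((k * m) * (l * n)) ≡ - (k * l) * (m * n)
  eq₂ = solve-∀

unit-^-modulus : ∀ M {q} → IsUnit M q → ∀ n → IsUnit (M ^ n) q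
unit-^-modulus M     u ℕ.zero    = 0ℤ , 1∣ _
unit-^-modulus M {q} u (ℕ.suc n) = unit-*-modulus M (M ^ n) {q} u (unit-^-modulus M {q} u n)

mainTheorem11 : ∀ (p n : ℕ) → Prime p → p > 2 → n ≥ 1 →
    H1IsoS (p ^ n) × (p > 3 → H1Vanishes (p ^ n))
mainTheorem11 p n p-prime p>2 _ = h1IsoS 2-unit , λ p>3 → h1Vanishes 2-unit (unit p>3)
  where
  open Cohomology
  unit : ∀ {q} .{{_ : ℕ.NonZero q}} → q ℕ.< p → IsUnit (p ^ n) (+ q)
  unit {q} q<p = unit-^-modulus p {+ q} (prime⇒unit p-prime q<p) n
  2-unit : IsUnit (p ^ n) (+ 2)
  2-unit = unit p>2
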